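{- The number $m_n$ of non-crossing merging-free partitions of $[n]$ satisfies $m_1=1$ and $m_n=2^{n-2}$ for all $n\ge2$.
   Context: A set partition $P=B_1/\cdots/B_k$ of $[n]$ in block representation has blocks ordered by increasing minima. $P$ is merging-free if $\max B_i>\min B_{i+1}$ for $1\le i\le k-1$. $P$ is non-crossing if there are no $a<x<b<y$ with $a,b$ in one block and $x,y$ in a different block. -}

module Defs where

open import Data.Nat using (ℕ; zero; suc; _≤_)
open import Data.Fin using (Fin; _<_)
open import Data.Vec using (Vec; lookup)
open import Data.List using (List; length)
open import Data.List.Membership.Propositional using (_∈_)
open import Data.List.Relation.Unary.Unique.Propositional using (Unique)
open import Data.Product using (Σ; ∃; _×_)
open import Relation.Nullary using (¬_)
open import Relation.Binary.PropositionalEquality using (_≡_; _≢_)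
open import Function.Bundles using (_⇔_)

-- A set partition of [n] = {1,…,n} (element i+1 is represented by i : Fin n)
-- in block representation B_1/…/B_k is encoded by the vector v of block
-- labels: v[x] = j means that x lies in block B_{j+1}.  The blocks are
-- ordered by increasing minima, i.e. every smaller label j' < v[x] already
-- occurs strictly before x (restricted-growth condition).  This encoding
-- is a bijection with set partitions of [n] whose blocks are listed by
-- increasing minima.
label : ∀ {n} → Vec ℕ n → Fin n → ℕ
label v x = lookup v x

IsSetPartition : ∀ {n} → Vec ℕ n → Set
IsSetPartition {n} v =
  ∀ (x : Fin n) (j : ℕ) → suc j ≤ label v x → ∃ λ (y : Fin n) → y < x × label v y ≡ j

NonCrossing : ∀ {n} → Vec ℕ n → Set
NonCrossing {n} v =
  ¬ (Σ (Fin n) λ a → Σ (Fin n) λ x → Σ (Fin n) λ b → Σ (Fin n) λ y →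
       a < x × x < b × b < y ×
       label v a ≡ label v b × label v x ≡ label v y × label v a ≢ label v x)

-- Merging-free: max B_i > min B_{i+1} for every pair of consecutive blocks,
-- i.e. whenever block with label (j+1) exists (then so does block j),
-- some element of block j exceeds some element of block j+1.
MergingFree : ∀ {n} → Vec ℕ n → Set
MergingFree {n} v =
  ∀ (j : ℕ) (z : Fin n) → label v z ≡ suc j →
    Σ (Fin n) λ a → Σ (Fin n) λ b →
      label v a ≡ j × label v b ≡ suc j × b < a

NCMF : ∀ {n} → Vec ℕ n → Set
NCMF v = IsSetPartition v × NonCrossing v × MergingFree v

NumberOfNCMF : ℕ → ℕ → Set
NumberOfNCMF n m =
  Σ (List (Vec ℕ n)) λ L →
    Unique L × (∀ (v : Vec ℕ n) → (v ∈ L) ⇔ NCMF v) × length L ≡ m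

-- If 1 and 2
-- share a block, deleting 1 leaves an arbitrary NCMF partition of [n - 1].
-- If they do not, merging-freeness and non-crossing force n into the block
-- of 1, and once that block reappears after 2 every later element lies in
-- it.  So either n - 1 is in the block of 1 as well, and deleting n leaves an
-- NCMF partition of [n - 1] with 1, 2 in different blocks; or the partition
-- is the block {1, n} enclosing an NCMF partition of {2, …, n - 1}, which
-- becomes an NCMF partition of [n - 1] with 1, 2 in the same block by adding
-- 1.  Hence m_n = 2 m_(n-1) for n ≥ 3.
module Submission where

open import Defs
open import Data.Nat using (ℕ; zero; suc; pred; _+_; _≤_; _<_; _^_; _∸_; z≤n; s≤s; s<s⁻¹)
open import Data.Nat.Properties
  using (0≢1+n; suc-injective; ≤-refl; <-cmp; <-trans; <-≤-trans; <-irrefl; <-asym; <⇒≱; m<1+n⇒m≤n; m≤n⇒m<n∨m≡n; +-identityʳ)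
open import Data.Fin using (Fin; toℕ; zero; suc)
open import Data.List using (List; []; _∷_; _++_; _∷ʳ_; map; length)
open import Data.List.Properties using (length-map; length-++)
open import Data.List.Membership.Propositional using (_∈_)
open import Data.List.Membership.Propositional.Properties using (∈-map⁺; ∈-map⁻; ∈-++⁺ˡ; ∈-++⁺ʳ; ∈-++⁻)
open import Data.List.Relation.Unary.Any using (here; there)
open import Data.List.Relation.Unary.All as All using (All; []; _∷_)
open import Data.List.Relation.Unary.All.Properties using () renaming (map⁺ to All-map⁺)
open import Data.List.Relation.Unary.Unique.Propositional using (Unique; []; _∷_)
import Data.List.Relation.Unary.Unique.Propositional.Properties as Unique
open import Data.Vec as Vec using (Vec; []; _∷_; lookup; toList)
open import Data.Vec.Properties using (∷-injectiveˡ; ∷-injectiveʳ; ∷ʳ-injectiveˡ; last-∷ʳ; toList-∷ʳ; toList-map; length-toList)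
open import Data.Product using (∃; ∃₂; _×_; _,_; proj₁; proj₂)
open import Data.Sum using (_⊎_; inj₁; inj₂)
open import Data.Empty using (⊥; ⊥-elim)
open import Function using (_∘_)
open import Function.Bundles using (mk⇔)
open import Relation.Binary using (tri<; tri≈; tri>)
open import Relation.Nullary using (¬_)
open import Relation.Binary.PropositionalEquality using (_≡_; _≢_; refl; sym; trans; cong; cong₂; subst; module ≡-Reasoning)

infix 4 _[_]=_

data _[_]=_ {A : Set} : List A → ℕ → A → Set where
  here  : ∀ {x xs} → (x ∷ xs) [ 0 ]= x
  there : ∀ {y xs i x} → xs [ i ]= x → (y ∷ xs) [ suc i ]= x

module _ {A : Set} where

  []=-functional : ∀ {xs : List A} {i x y} → xs [ i ]= x → xs [ i ]= y → x ≡ y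
  []=-functional here      here      = refl
  []=-functional (there p) (there q) = []=-functional p q

  []=⇒<length : ∀ {xs : List A} {i x} → xs [ i ]= x → i < length xs
  []=⇒<length here      = s≤s z≤n
  []=⇒<length (there p) = s≤s ([]=⇒<length p)

  <length⇒[]= : ∀ (xs : List A) {i} → i < length xs → ∃ λ x → xs [ i ]= x
  <length⇒[]= (x ∷ xs) {zero}  _       = x , here
  <length⇒[]= (x ∷ xs) {suc i} (s≤s p) = let y , q = <length⇒[]= xs p in y , there q

  []=-++⁺ˡ : ∀ {xs ys : List A} {i x} → xs [ i ]= x → (xs ++ ys) [ i ]= x
  []=-++⁺ˡ here      = here
  []=-++⁺ˡ (there p) = there ([]=-++⁺ˡ p)

  []=-∷ʳ : ∀ (xs : List A) {x} → (xs ∷ʳ x) [ length xs ]= x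
  []=-∷ʳ []       = here
  []=-∷ʳ (y ∷ xs) = there ([]=-∷ʳ xs)

  []=-∷ʳ⁻ : ∀ (xs : List A) {z i x} → (xs ∷ʳ z) [ i ]= x →
            (i < length xs × xs [ i ]= x) ⊎ (i ≡ length xs × x ≡ z)
  []=-∷ʳ⁻ []       here       = inj₂ (refl , refl)
  []=-∷ʳ⁻ (y ∷ xs) here       = inj₁ (s≤s z≤n , here)
  []=-∷ʳ⁻ (y ∷ xs) (there p) with []=-∷ʳ⁻ xs p
  ... | inj₁ (i<n , q) = inj₁ (s≤s i<n , there q)
  ... | inj₂ (i≡n , x≡z) = inj₂ (cong suc i≡n , x≡z)

  []=-∷ʳ-init : ∀ (xs : List A) {z i x} → (xs ∷ʳ z) [ i ]= x → i < length xs → xs [ i ]= x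
  []=-∷ʳ-init xs p i<n with []=-∷ʳ⁻ xs p
  ... | inj₁ (_ , q)    = q
  ... | inj₂ (refl , _) = ⊥-elim (<-irrefl refl i<n)

module _ {A B : Set} (f : A → B) where

  []=-map⁺ : ∀ {xs i x} → xs [ i ]= x → map f xs [ i ]= f x
  []=-map⁺ here      = here
  []=-map⁺ (there p) = there ([]=-map⁺ p)

  []=-map⁻ : ∀ (xs : List A) {i y} → map f xs [ i ]= y → ∃ λ x → f x ≡ y × xs [ i ]= x
  []=-map⁻ (x ∷ xs) here      = x , refl , here
  []=-map⁻ (x ∷ xs) (there p) = let x′ , fx′≡y , q = []=-map⁻ xs p in x′ , fx′≡y , there q

IsRGS : List ℕ → Set
IsRGS xs = ∀ {i c} → xs [ i ]= c → ∀ j → j < c → ∃ λ i′ → i′ < i × xs [ i′ ]= j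

IsNonCrossing : List ℕ → Set
IsNonCrossing xs = ∀ {a x b y c d} → a < x → x < b → b < y →
  xs [ a ]= c → xs [ b ]= c → xs [ x ]= d → xs [ y ]= d → c ≢ d → ⊥

IsMergingFree : List ℕ → Set
IsMergingFree xs = ∀ j {z} → xs [ z ]= suc j →
  ∃₂ λ a b → xs [ a ]= j × xs [ b ]= suc j × b < a

IsNCMF : List ℕ → Set
IsNCMF xs = IsRGS xs × IsNonCrossing xs × IsMergingFree xs

lookup⇒[]= : ∀ {n} (v : Vec ℕ n) (p : Fin n) → toList v [ toℕ p ]= lookup v p
lookup⇒[]= (x ∷ v) zero    = here
lookup⇒[]= (x ∷ v) (suc p) = there (lookup⇒[]= v p)

lookup≡⇒[]= : ∀ {n} (v : Vec ℕ n) {p c} → lookup v p ≡ c → toList v [ toℕ p ]= c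
lookup≡⇒[]= v {p} refl = lookup⇒[]= v p

[]=⇒lookup : ∀ {n} (v : Vec ℕ n) {i c} → toList v [ i ]= c →
             ∃ λ (p : Fin n) → toℕ p ≡ i × lookup v p ≡ c
[]=⇒lookup (x ∷ v) here      = zero , refl , refl
[]=⇒lookup (x ∷ v) (there q) = let p , p≡i , vp≡c = []=⇒lookup v q in suc p , cong suc p≡i , vp≡c

NCMF⇒IsNCMF : ∀ {n} (v : Vec ℕ n) → NCMF v → IsNCMF (toList v)
NCMF⇒IsNCMF v (sp , nc , mf) = rgs , nc′ , mf′
  where
  rgs : IsRGS (toList v)
  rgs q j j<c with []=⇒lookup v q
  ... | p , refl , refl = let y , y<p , vy≡j = sp p j j<c in toℕ y , y<p , lookup≡⇒[]= v vy≡j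

  nc′ : IsNonCrossing (toList v)
  nc′ a<x x<b b<y qa qb qx qy c≢d with []=⇒lookup v qa | []=⇒lookup v qb | []=⇒lookup v qx | []=⇒lookup v qy
  ... | pa , refl , ea | pb , refl , eb | px , refl , ex | py , refl , ey =
    nc (pa , px , pb , py , a<x , x<b , b<y , trans ea (sym eb) , trans ex (sym ey) ,
        λ e → c≢d (trans (sym ea) (trans e ex)))

  mf′ : IsMergingFree (toList v)
  mf′ j q with []=⇒lookup v q
  ... | z , refl , ez = let a , b , ea , eb , b<a = mf j z ez in toℕ a , toℕ b , lookup≡⇒[]= v ea , lookup≡⇒[]= v eb , b<a

IsNCMF⇒NCMF : ∀ {n} (v : Vec ℕ n) → IsNCMF (toList v) → NCMF v
IsNCMF⇒NCMF v (rgs , nc , mf) = sp , nc′ , mf′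
  where
  sp : IsSetPartition v
  sp x j j<c with rgs (lookup⇒[]= v x) j j<c
  ... | _ , y<x , q with []=⇒lookup v q
  ...   | y , refl , vy≡j = y , y<x , vy≡j

  nc′ : NonCrossing v
  nc′ (a , x , b , y , a<x , x<b , b<y , va≡vb , vx≡vy , va≢vx) =
    nc a<x x<b b<y (lookup⇒[]= v a) (lookup≡⇒[]= v (sym va≡vb)) (lookup⇒[]= v x) (lookup≡⇒[]= v (sym vx≡vy)) va≢vx

  mf′ : MergingFree v
  mf′ j z vz≡1+j with mf j (lookup≡⇒[]= v vz≡1+j)
  ... | _ , _ , qa , qb , b<a with []=⇒lookup v qa | []=⇒lookup v qb
  ...   | a , refl , ea | b , refl , eb = a , b , ea , eb , b<a

IsRGS⇒head≡0 : ∀ {xs c} → IsRGS xs → xs [ 0 ]= c → c ≡ 0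
IsRGS⇒head≡0 {c = zero}  rgs p = refl
IsRGS⇒head≡0 {c = suc c} rgs p with rgs p 0 (s≤s z≤n)
... | _ , () , _

IsRGS⇒second≤1 : ∀ {xs c} → IsRGS xs → xs [ 1 ]= suc c → c ≡ 0
IsRGS⇒second≤1 {c = zero}  rgs p = refl
IsRGS⇒second≤1 {c = suc c} rgs p with rgs p 1 (s≤s (s≤s z≤n))
... | zero  , _ , q = ⊥-elim (0≢1+n (sym (IsRGS⇒head≡0 rgs q)))
... | suc _ , s≤s () , _

IsNCMF-[0] : IsNCMF (0 ∷ [])
IsNCMF-[0] = rgs , nc , mf
  where
  rgs : IsRGS (0 ∷ [])
  rgs here j ()
  nc : IsNonCrossing (0 ∷ [])
  nc a<x x<b b<y qa qb qx (there ())
  nc a<x x<b () qa qb qx here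
  mf : IsMergingFree (0 ∷ [])
  mf j (there ())

IsNCMF-0∷⁺ : ∀ {xs} → IsNCMF xs → xs [ 0 ]= 0 → IsNCMF (0 ∷ xs)
IsNCMF-0∷⁺ {xs} (rgs , nc , mf) xs₀≡0 = rgs′ , nc′ , mf′
  where
  rgs′ : IsRGS (0 ∷ xs)
  rgs′ here      j ()
  rgs′ (there p) j j<c = let i , i<i′ , q = rgs p j j<c in suc i , s≤s i<i′ , there q

  nc′ : IsNonCrossing (0 ∷ xs)
  nc′ a<x () b<y qa here (there qx) qy c≢d
  nc′ a<x x<b b<y here (there qb) (there {i = zero} qx) (there qy) c≢d =
    c≢d ([]=-functional xs₀≡0 qx)
  nc′ a<x (s≤s x<b) (s≤s b<y) here (there qb) (there {i = suc _} qx) (there qy) c≢d =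
    nc (s≤s z≤n) x<b b<y xs₀≡0 qb qx qy c≢d
  nc′ (s≤s a<x) (s≤s x<b) (s≤s b<y) (there qa) (there qb) (there qx) (there qy) c≢d =
    nc a<x x<b b<y qa qb qx qy c≢d

  mf′ : IsMergingFree (0 ∷ xs)
  mf′ j (there p) = let a , b , qa , qb , b<a = mf j p in suc a , suc b , there qa , there qb , s≤s b<a

IsNCMF-0∷⁻ : ∀ {xs} → IsNCMF (0 ∷ xs) → xs [ 0 ]= 0 → IsNCMF xs
IsNCMF-0∷⁻ {xs} (rgs , nc , mf) xs₀≡0 = rgs′ , nc′ , mf′
  where
  rgs′ : IsRGS xs
  rgs′ p j j<c with rgs (there p) j j<c
  rgs′ {zero}  p j j<c | zero , _ , here = ⊥-elim (<-irrefl ([]=-functional xs₀≡0 p) j<c)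
  rgs′ {suc _} p j j<c | zero , _ , here = 0 , s≤s z≤n , xs₀≡0
  rgs′ p j j<c | suc i , s≤s i<i′ , there q = i , i<i′ , q

  nc′ : IsNonCrossing xs
  nc′ a<x x<b b<y qa qb qx qy = nc (s≤s a<x) (s≤s x<b) (s≤s b<y) (there qa) (there qb) (there qx) (there qy)

  mf′ : IsMergingFree xs
  mf′ j p with mf j (there p)
  ... | suc a , suc b , there qa , there qb , s≤s b<a = a , b , qa , qb , b<a

IsNCMF-∷ʳ0⁺ : ∀ {xs k} → IsNCMF xs → xs [ k ]= 0 → suc k ≡ length xs → IsNCMF (xs ∷ʳ 0)
IsNCMF-∷ʳ0⁺ {xs} {k} (rgs , nc , mf) xsₖ≡0 1+k≡n = rgs′ , nc′ , mf′
  where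
  old : ∀ {i c} → (xs ∷ʳ 0) [ i ]= c → i < length xs → xs [ i ]= c
  old = []=-∷ʳ-init xs

  rgs′ : IsRGS (xs ∷ʳ 0)
  rgs′ p j j<c with []=-∷ʳ⁻ xs p
  ... | inj₁ (_ , q) = let i , i<i′ , q′ = rgs q j j<c in i , i<i′ , []=-++⁺ˡ q′
  ... | inj₂ (_ , refl) with j<c
  ...   | ()

  nc′ : IsNonCrossing (xs ∷ʳ 0)
  nc′ {a} {x} {b} {y} a<x x<b b<y qa qb qx qy c≢d with []=-∷ʳ⁻ xs qy
  ... | inj₁ (y<n , qy′) =
    nc a<x x<b b<y (old qa (<-trans a<x (<-trans x<b (<-trans b<y y<n))))
       (old qb (<-trans b<y y<n)) (old qx (<-trans x<b (<-trans b<y y<n))) qy′ c≢d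
  ... | inj₂ (refl , refl) with m≤n⇒m<n∨m≡n (m<1+n⇒m≤n (subst (b <_) (sym 1+k≡n) b<y))
  ...   | inj₂ refl = c≢d ([]=-functional (old qb b<y) xsₖ≡0)
  ...   | inj₁ b<k  = nc a<x x<b b<k (old qa (<-trans a<x (<-trans x<b b<y))) (old qb b<y)
                         (old qx (<-trans x<b b<y)) xsₖ≡0 c≢d

  mf′ : IsMergingFree (xs ∷ʳ 0)
  mf′ j p with []=-∷ʳ⁻ xs p
  ... | inj₁ (_ , q) = let a , b , qa , qb , b<a = mf j q in a , b , []=-++⁺ˡ qa , []=-++⁺ˡ qb , b<a

IsNCMF-∷ʳ0⁻ : ∀ {xs k} → IsNCMF (xs ∷ʳ 0) → xs [ k ]= 0 → suc k ≡ length xs → IsNCMF xs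
IsNCMF-∷ʳ0⁻ {xs} {k} (rgs , nc , mf) xsₖ≡0 1+k≡n = rgs′ , nc′ , mf′
  where
  rgs′ : IsRGS xs
  rgs′ p j j<c = let i , i<i′ , q = rgs ([]=-++⁺ˡ p) j j<c
                 in i , i<i′ , []=-∷ʳ-init xs q (<-trans i<i′ ([]=⇒<length p))

  nc′ : IsNonCrossing xs
  nc′ a<x x<b b<y qa qb qx qy = nc a<x x<b b<y ([]=-++⁺ˡ qa) ([]=-++⁺ˡ qb) ([]=-++⁺ˡ qx) ([]=-++⁺ˡ qy)

  -- If the witness a of the merge condition is the appended element, the
  -- original last element (label 0) serves instead.
  mf′ : IsMergingFree xs
  mf′ j p with mf j ([]=-++⁺ˡ p)
  ... | a , b , qa , qb , b<a with []=-∷ʳ⁻ xs qb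
  ...   | inj₁ (b<n , qb′) with []=-∷ʳ⁻ xs qa
  ...     | inj₁ (_ , qa′) = a , b , qa′ , qb′ , b<a
  ...     | inj₂ (refl , refl) with m≤n⇒m<n∨m≡n (m<1+n⇒m≤n (subst (b <_) (sym 1+k≡n) b<n))
  ...       | inj₁ b<k  = k , b , xsₖ≡0 , qb′ , b<k
  ...       | inj₂ refl = ⊥-elim (0≢1+n ([]=-functional xsₖ≡0 qb′))

-- A new block {1, n} enclosing a partition of {2, …, n - 1}.

enclose : List ℕ → List ℕ
enclose w = 0 ∷ (map suc w ∷ʳ 0)

length-enclose : ∀ w → length (enclose w) ≡ suc (suc (length w))
length-enclose []      = refl
length-enclose (x ∷ w) = cong suc (length-enclose w)

[]=-enclose⁺ : ∀ {w i c} → w [ i ]= c → enclose w [ suc i ]= suc c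
[]=-enclose⁺ p = there ([]=-++⁺ˡ ([]=-map⁺ suc p))

[]=-enclose-last : ∀ w → enclose w [ suc (length w) ]= 0
[]=-enclose-last w = there (subst (λ i → (map suc w ∷ʳ 0) [ i ]= 0) (length-map suc w) ([]=-∷ʳ (map suc w)))

[]=-enclose-suc⁻ : ∀ w {i c} → enclose w [ i ]= suc c → ∃ λ i′ → i ≡ suc i′ × w [ i′ ]= c
[]=-enclose-suc⁻ w (there p) with []=-∷ʳ⁻ (map suc w) p
... | inj₁ (_ , q) with []=-map⁻ suc w q
...   | _ , refl , q′ = _ , refl , q′

[]=-enclose-0⁻ : ∀ w {i} → enclose w [ i ]= 0 → i ≡ 0 ⊎ i ≡ suc (length w)
[]=-enclose-0⁻ w here      = inj₁ refl
[]=-enclose-0⁻ w (there p) with []=-∷ʳ⁻ (map suc w) p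
... | inj₂ (i≡n , _) = inj₂ (cong suc (trans i≡n (length-map suc w)))
... | inj₁ (_ , q) with []=-map⁻ suc w q
...   | _ , () , _

IsNCMF-enclose⁺ : ∀ {w} → IsNCMF w → w [ 0 ]= 0 → IsNCMF (enclose w)
IsNCMF-enclose⁺ {w} (rgs , nc , mf) w₀≡0 = rgs′ , nc′ , mf′
  where
  rgs′ : IsRGS (enclose w)
  rgs′ {c = suc c} p zero _ with []=-enclose-suc⁻ w p
  ... | _ , refl , _ = 0 , s≤s z≤n , here
  rgs′ {c = suc c} p (suc j) (s≤s j<c) with []=-enclose-suc⁻ w p
  ... | _ , refl , q = let i , i<i′ , q′ = rgs q j j<c in suc i , s≤s i<i′ , []=-enclose⁺ q′

  nc′ : IsNonCrossing (enclose w)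
  nc′ {c = zero} a<x x<b b<y qa qb qx qy c≢d with []=-enclose-0⁻ w qb
  ... | inj₁ refl with <-trans a<x x<b
  ...   | ()
  nc′ {y = y} {c = zero} a<x x<b b<y qa qb qx qy c≢d | inj₂ refl =
    <⇒≱ b<y (m<1+n⇒m≤n (subst (y <_) (length-enclose w) ([]=⇒<length qy)))
  nc′ {c = suc c} {d = zero} a<x x<b b<y qa qb qx qy c≢d
    with []=-enclose-suc⁻ w qa | []=-enclose-suc⁻ w qb | []=-enclose-0⁻ w qx
  ... | _ , refl , _ | _ , refl , qb′ | inj₁ refl with a<x
  ...   | ()
  nc′ {c = suc c} {d = zero} a<x x<b b<y qa qb qx qy c≢d | _ , refl , _ | _ , refl , qb′ | inj₂ refl =
    <-asym ([]=⇒<length qb′) (s<s⁻¹ x<b)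
  nc′ {c = suc c} {d = suc d} (s≤s a<x) (s≤s x<b) (s≤s b<y) qa qb qx qy c≢d
    with []=-enclose-suc⁻ w qa | []=-enclose-suc⁻ w qb | []=-enclose-suc⁻ w qx | []=-enclose-suc⁻ w qy
  ... | _ , refl , qa′ | _ , refl , qb′ | _ , refl , qx′ | _ , refl , qy′ =
    nc a<x x<b b<y qa′ qb′ qx′ qy′ (c≢d ∘ cong suc)

  mf′ : IsMergingFree (enclose w)
  mf′ zero p with []=-enclose-suc⁻ w p
  ... | _ , refl , _ = suc (length w) , 1 , []=-enclose-last w , []=-enclose⁺ w₀≡0 , s≤s ([]=⇒<length w₀≡0)
  mf′ (suc j) p with []=-enclose-suc⁻ w p
  ... | _ , refl , q = let a , b , qa , qb , b<a = mf j q
                       in suc a , suc b , []=-enclose⁺ qa , []=-enclose⁺ qb , s≤s b<a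

IsNCMF-enclose⁻ : ∀ {w} → IsNCMF (enclose w) → IsNCMF w
IsNCMF-enclose⁻ {w} (rgs , nc , mf) = rgs′ , nc′ , mf′
  where
  rgs′ : IsRGS w
  rgs′ p j j<c with rgs ([]=-enclose⁺ p) (suc j) (s≤s j<c)
  ... | _ , i<i′ , q with []=-enclose-suc⁻ w q
  ...   | i , refl , q′ = i , s<s⁻¹ i<i′ , q′

  nc′ : IsNonCrossing w
  nc′ a<x x<b b<y qa qb qx qy c≢d =
    nc (s≤s a<x) (s≤s x<b) (s≤s b<y) ([]=-enclose⁺ qa) ([]=-enclose⁺ qb) ([]=-enclose⁺ qx) ([]=-enclose⁺ qy)
       (c≢d ∘ suc-injective)

  mf′ : IsMergingFree w
  mf′ j p with mf (suc j) ([]=-enclose⁺ p)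
  ... | _ , _ , qa , qb , b<a with []=-enclose-suc⁻ w qa | []=-enclose-suc⁻ w qb
  ...   | a , refl , qa′ | b , refl , qb′ = a , b , qa′ , qb′ , s<s⁻¹ b<a

¬nonzero-after-inner-0 : ∀ {xs p q c} → IsNCMF xs → xs [ 0 ]= 0 → xs [ 1 ]= 1 →
                         1 < p → xs [ p ]= 0 → p < q → ¬ xs [ q ]= suc c
¬nonzero-after-inner-0 {c = zero} (_ , nc , _) xs₀≡0 xs₁≡1 1<p xsₚ≡0 p<q xs_q≡1 =
  nc (s≤s z≤n) 1<p p<q xs₀≡0 xsₚ≡0 xs₁≡1 xs_q≡1 0≢1+n
-- Otherwise the merge condition gives b in the block of q and a > b in the
-- previous block; b cannot lie before p (crossing), so a lies after p and we
-- descend to the previous block.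
¬nonzero-after-inner-0 {p = p} {c = suc c} h@(_ , nc , mf) xs₀≡0 xs₁≡1 1<p xsₚ≡0 p<q xs_q≡c
  with mf (suc c) xs_q≡c
... | a , b , qa , qb , b<a with <-cmp b p
...   | tri≈ _ refl _ = 0≢1+n ([]=-functional xsₚ≡0 qb)
...   | tri> _ _ p<b = ¬nonzero-after-inner-0 h xs₀≡0 xs₁≡1 1<p xsₚ≡0 (<-trans p<b b<a) qa
...   | tri< b<p _ _ with b
...     | zero  = 0≢1+n ([]=-functional xs₀≡0 qb)
...     | suc _ = nc (s≤s z≤n) b<p p<q xs₀≡0 xsₚ≡0 qb xs_q≡c 0≢1+n

IsNCMF-last≡0 : ∀ {xs k} → IsNCMF xs → xs [ 0 ]= 0 → xs [ 1 ]= 1 → suc k ≡ length xs → xs [ k ]= 0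
IsNCMF-last≡0 {xs} {k} h@(_ , _ , mf) xs₀≡0 xs₁≡1 1+k≡n with mf 0 xs₁≡1
... | a , zero  , qa , qb , b<a = ⊥-elim (0≢1+n ([]=-functional xs₀≡0 qb))
... | a , suc b , qa , qb , b<a with m≤n⇒m<n∨m≡n (m<1+n⇒m≤n (subst (a <_) (sym 1+k≡n) ([]=⇒<length qa)))
...   | inj₂ refl = qa
...   | inj₁ a<k with <length⇒[]= xs (subst (k <_) 1+k≡n ≤-refl)
...     | zero  , qk = qk
...     | suc _ , qk = ⊥-elim (¬nonzero-after-inner-0 h xs₀≡0 xs₁≡1 (<-≤-trans (s≤s (s≤s z≤n)) b<a) qa a<k qk)

¬0-before-nonzero : ∀ {xs m s i} → IsNCMF xs → xs [ 0 ]= 0 → xs [ 1 ]= 1 → xs [ m ]= suc s →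
                    0 < i → i ≤ m → ¬ xs [ i ]= 0
¬0-before-nonzero {i = suc zero} h xs₀≡0 xs₁≡1 xsₘ≢0 _ _ xsᵢ≡0 = 0≢1+n ([]=-functional xsᵢ≡0 xs₁≡1)
¬0-before-nonzero {i = suc (suc i)} h xs₀≡0 xs₁≡1 xsₘ≢0 _ i≤m xsᵢ≡0 with m≤n⇒m<n∨m≡n i≤m
... | inj₂ refl = 0≢1+n ([]=-functional xsᵢ≡0 xsₘ≢0)
... | inj₁ i<m  = ¬nonzero-after-inner-0 h xs₀≡0 xs₁≡1 (s≤s (s≤s z≤n)) xsᵢ≡0 i<m xsₘ≢0

module _ {A : Set} where

  []=-toList-∷ʳ : ∀ {n} (v : Vec A n) x → toList (v Vec.∷ʳ x) [ n ]= x
  []=-toList-∷ʳ []      x = here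
  []=-toList-∷ʳ (y ∷ v) x = there ([]=-toList-∷ʳ v x)

  []=-toList-∷ʳ⁺ : ∀ {n} (v : Vec A n) {z i x} → toList v [ i ]= x → toList (v Vec.∷ʳ z) [ i ]= x
  []=-toList-∷ʳ⁺ (y ∷ v) here      = here
  []=-toList-∷ʳ⁺ (y ∷ v) (there p) = there ([]=-toList-∷ʳ⁺ v p)

  []=-toList-last : ∀ {n} (v : Vec A (suc n)) → toList v [ n ]= Vec.last v
  []=-toList-last (x ∷ [])    = here
  []=-toList-last (x ∷ y ∷ v) = there ([]=-toList-last (y ∷ v))

module _ {A B : Set} {f : A → B} where

  last-map : ∀ {n} (v : Vec A (suc n)) → Vec.last (Vec.map f v) ≡ f (Vec.last v)
  last-map (x ∷ [])    = refl
  last-map (x ∷ y ∷ v) = last-map (y ∷ v)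

  map-injective : (∀ {x y} → f x ≡ f y → x ≡ y) → ∀ {n} {v w : Vec A n} → Vec.map f v ≡ Vec.map f w → v ≡ w
  map-injective f-inj {v = []}    {[]}    _ = refl
  map-injective f-inj {v = x ∷ v} {y ∷ w} e = cong₂ _∷_ (f-inj (∷-injectiveˡ e)) (map-injective f-inj (∷-injectiveʳ e))

map-suc-pred : ∀ {k} (r : Vec ℕ k) → (∀ {i c} → toList r [ i ]= c → c ≢ 0) → Vec.map suc (Vec.map pred r) ≡ r
map-suc-pred []          _  = refl
map-suc-pred (zero  ∷ r) nz = ⊥-elim (nz here refl)
map-suc-pred (suc x ∷ r) nz = cong (suc x ∷_) (map-suc-pred r (nz ∘ there))

-- Appending n + 1 to an NCMF partition of [n]: if 1 and 2 share a block,
-- 1 is split off into the new block {1, n + 1} enclosing the rest;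
-- otherwise n + 1 joins the block of 1.
grow : ∀ {k} → Vec ℕ (2 + k) → Vec ℕ (3 + k)
grow (_ ∷ zero  ∷ w) = 0 ∷ (Vec.map suc (0 ∷ w) Vec.∷ʳ 0)
grow (x ∷ suc y ∷ w) = (x ∷ suc y ∷ w) Vec.∷ʳ 0

toList-grow-0 : ∀ {k} x (w : Vec ℕ k) → toList (grow (x ∷ 0 ∷ w)) ≡ enclose (toList (0 ∷ w))
toList-grow-0 x w = cong (0 ∷_) (trans (toList-∷ʳ 0 (Vec.map suc (0 ∷ w))) (cong (_∷ʳ 0) (toList-map suc (0 ∷ w))))

IsNCMF-toList-0∷ : ∀ {k} (u : Vec ℕ (suc k)) → IsNCMF (toList u) → IsNCMF (toList (0 ∷ u))
IsNCMF-toList-0∷ (x ∷ w) h with IsRGS⇒head≡0 (proj₁ h) here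
... | refl = IsNCMF-0∷⁺ h here

IsNCMF-grow : ∀ {k} (u : Vec ℕ (2 + k)) → IsNCMF (toList u) → IsNCMF (toList (grow u))
IsNCMF-grow (x ∷ zero ∷ w) h with IsRGS⇒head≡0 (proj₁ h) here
... | refl = subst IsNCMF (sym (toList-grow-0 0 w)) (IsNCMF-enclose⁺ (IsNCMF-0∷⁻ h here) here)
IsNCMF-grow {k} (x ∷ suc y ∷ w) h with IsRGS⇒head≡0 (proj₁ h) here | IsRGS⇒second≤1 (proj₁ h) (there here)
... | refl | refl =
  subst IsNCMF (sym (toList-∷ʳ 0 (0 ∷ 1 ∷ w))) (IsNCMF-∷ʳ0⁺ h (IsNCMF-last≡0 h here (there here) 1+k≡n) 1+k≡n)
  where
  1+k≡n : suc (suc k) ≡ length (toList (0 ∷ 1 ∷ w))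
  1+k≡n = sym (length-toList (0 ∷ 1 ∷ w))

grow⁻ : ∀ {k} (s : Vec ℕ k) → IsNCMF (toList (0 ∷ 1 ∷ (s Vec.∷ʳ 0))) →
        ∃ λ u → IsNCMF (toList u) × grow u ≡ 0 ∷ 1 ∷ (s Vec.∷ʳ 0)
grow⁻ {k} s h with Vec.last (1 ∷ s) | []=-toList-last (1 ∷ s)
... | zero | last≡0 =
  0 ∷ 1 ∷ s , IsNCMF-∷ʳ0⁻ (subst IsNCMF (toList-∷ʳ 0 (0 ∷ 1 ∷ s)) h) (there last≡0) (sym (length-toList (0 ∷ 1 ∷ s))) , refl
... | suc _ | last≢0 = 0 ∷ 0 ∷ t , IsNCMF-toList-0∷ (0 ∷ t) (IsNCMF-enclose⁻ h′) , grow≡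
  where
  s-nonzero : ∀ {i c} → toList s [ i ]= c → c ≢ 0
  s-nonzero {i} q refl =
    ¬0-before-nonzero h here (there here) (there ([]=-toList-∷ʳ⁺ (1 ∷ s) last≢0)) (s≤s z≤n)
      (s≤s (subst (i <_) (length-toList s) ([]=⇒<length q))) (there (there ([]=-toList-∷ʳ⁺ s q)))
  t : Vec ℕ k
  t = Vec.map pred s
  grow≡ : grow (0 ∷ 0 ∷ t) ≡ 0 ∷ 1 ∷ (s Vec.∷ʳ 0)
  grow≡ = cong (λ r → 0 ∷ 1 ∷ (r Vec.∷ʳ 0)) (map-suc-pred s s-nonzero)
  h′ : IsNCMF (enclose (toList (0 ∷ t)))
  h′ = subst IsNCMF (toList-grow-0 0 t) (subst (IsNCMF ∘ toList) (sym grow≡) h)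

IsNCMF-split : ∀ {k} (v : Vec ℕ (3 + k)) → IsNCMF (toList v) →
               ∃ λ u → IsNCMF (toList u) × (v ≡ 0 ∷ u ⊎ v ≡ grow u)
IsNCMF-split (x ∷ y ∷ r) h with IsRGS⇒head≡0 (proj₁ h) here
IsNCMF-split (_ ∷ zero  ∷ r) h | refl = 0 ∷ r , IsNCMF-0∷⁻ h here , inj₁ refl
IsNCMF-split (_ ∷ suc _ ∷ r) h | refl with IsRGS⇒second≤1 (proj₁ h) (there here) | Vec.initLast r
... | refl | s , z , refl
  with []=-functional ([]=-toList-∷ʳ (0 ∷ 1 ∷ s) z)
         (IsNCMF-last≡0 h here (there here) (sym (length-toList (0 ∷ 1 ∷ (s Vec.∷ʳ z)))))
...   | refl = let u , hu , grow-u≡v = grow⁻ s h in u , hu , inj₂ (sym grow-u≡v)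

ncmfs : (k : ℕ) → List (Vec ℕ (2 + k))
ncmfs zero    = (0 ∷ 0 ∷ []) ∷ []
ncmfs (suc k) = map (0 ∷_) (ncmfs k) ++ map grow (ncmfs k)

ncmfs-sound : ∀ k {v} → v ∈ ncmfs k → IsNCMF (toList v)
ncmfs-sound zero (here refl) = IsNCMF-0∷⁺ IsNCMF-[0] here
ncmfs-sound (suc k) v∈ with ∈-++⁻ (map (0 ∷_) (ncmfs k)) v∈
... | inj₁ v∈₁ with ∈-map⁻ (0 ∷_) v∈₁
...   | u , u∈ , refl = IsNCMF-toList-0∷ u (ncmfs-sound k u∈)
ncmfs-sound (suc k) v∈ | inj₂ v∈₂ with ∈-map⁻ grow v∈₂
...   | u , u∈ , refl = IsNCMF-grow u (ncmfs-sound k u∈)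

ncmfs-complete : ∀ k (v : Vec ℕ (2 + k)) → IsNCMF (toList v) → v ∈ ncmfs k
ncmfs-complete zero (x ∷ y ∷ []) h with IsRGS⇒head≡0 (proj₁ h) here
ncmfs-complete zero (_ ∷ zero  ∷ []) h | refl = here refl
ncmfs-complete zero (_ ∷ suc _ ∷ []) h | refl with IsRGS⇒second≤1 (proj₁ h) (there here)
... | refl = ⊥-elim (0≢1+n ([]=-functional (IsNCMF-last≡0 h here (there here) refl) (there here)))
ncmfs-complete (suc k) v h with IsNCMF-split v h
... | u , hu , inj₁ refl = ∈-++⁺ˡ (∈-map⁺ (0 ∷_) (ncmfs-complete k u hu))
... | u , hu , inj₂ refl = ∈-++⁺ʳ (map (0 ∷_) (ncmfs k)) (∈-map⁺ grow (ncmfs-complete k u hu))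

ZeroEnded : ∀ {n} → Vec ℕ (suc n) → Set
ZeroEnded v = Vec.head v ≡ 0 × Vec.last v ≡ 0

grow-zeroEnded : ∀ {k} (u : Vec ℕ (2 + k)) → Vec.head u ≡ 0 → ZeroEnded (grow u)
grow-zeroEnded (_ ∷ zero  ∷ w) _   = refl , last-∷ʳ 0 (Vec.map suc (0 ∷ w))
grow-zeroEnded (x ∷ suc y ∷ w) x≡0 = x≡0 , last-∷ʳ 0 (x ∷ suc y ∷ w)

ncmfs-zeroEnded : ∀ k {v} → v ∈ ncmfs k → ZeroEnded v
ncmfs-zeroEnded zero (here refl) = refl , refl
ncmfs-zeroEnded (suc k) v∈ with ∈-++⁻ (map (0 ∷_) (ncmfs k)) v∈
... | inj₁ v∈₁ with ∈-map⁻ (0 ∷_) v∈₁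
...   | u , u∈ , refl = refl , proj₂ (ncmfs-zeroEnded k u∈)
ncmfs-zeroEnded (suc k) v∈ | inj₂ v∈₂ with ∈-map⁻ grow v∈₂
...   | u , u∈ , refl = grow-zeroEnded u (proj₁ (ncmfs-zeroEnded k u∈))

grow-0≢grow-suc : ∀ {k x x′ y′} (w w′ : Vec ℕ k) → Vec.last (x′ ∷ suc y′ ∷ w′) ≡ 0 →
                  grow (x ∷ 0 ∷ w) ≢ grow (x′ ∷ suc y′ ∷ w′)
grow-0≢grow-suc {x′ = x′} {y′ = y′} w w′ last≡0 e
  with ∷ʳ-injectiveˡ (0 ∷ Vec.map suc (0 ∷ w)) (x′ ∷ suc y′ ∷ w′) e
... | refl = 0≢1+n (trans (sym last≡0) (last-map (0 ∷ w)))

grow-injective : ∀ {k} {u u′ : Vec ℕ (2 + k)} → ZeroEnded u → ZeroEnded u′ → grow u ≡ grow u′ → u ≡ u′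
grow-injective {u = _ ∷ zero ∷ w} {_ ∷ zero ∷ w′} (refl , _) (refl , _) e =
  cong (λ r → 0 ∷ 0 ∷ r) (map-injective suc-injective (∷ʳ-injectiveˡ _ _ (∷-injectiveʳ (∷-injectiveʳ e))))
grow-injective {u = x ∷ zero ∷ w} {_ ∷ suc _ ∷ w′} _ (_ , last≡0) e =
  ⊥-elim (grow-0≢grow-suc {x = x} w w′ last≡0 e)
grow-injective {u = _ ∷ suc _ ∷ w} {x′ ∷ zero ∷ w′} (_ , last≡0) _ e =
  ⊥-elim (grow-0≢grow-suc {x = x′} w′ w last≡0 (sym e))
grow-injective {u = _ ∷ suc _ ∷ _} {_ ∷ suc _ ∷ _} _ _ e = ∷ʳ-injectiveˡ _ _ e

0∷≢grow : ∀ {k} (u u′ : Vec ℕ (2 + k)) → Vec.head u ≡ 0 → 0 ∷ u ≢ grow u′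
0∷≢grow (_ ∷ _) (_ ∷ zero  ∷ _) refl ()
0∷≢grow (_ ∷ _) (_ ∷ suc _ ∷ _) refl ()

Unique-map⁺-injectiveOn : ∀ {A B : Set} {P : A → Set} (f : A → B) →
                          (∀ {x y} → P x → P y → f x ≡ f y → x ≡ y) →
                          ∀ {xs} → All P xs → Unique xs → Unique (map f xs)
Unique-map⁺-injectiveOn f inj []         []           = []
Unique-map⁺-injectiveOn f inj (px ∷ pxs) (x∉xs ∷ xs-unique) =
  All-map⁺ (All.zipWith (λ { (x≢y , py) fx≡fy → x≢y (inj px py fx≡fy) }) (x∉xs , pxs)) ∷
  Unique-map⁺-injectiveOn f inj pxs xs-unique

ncmfs-unique : ∀ k → Unique (ncmfs k)
ncmfs-unique zero    = [] ∷ []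
ncmfs-unique (suc k) =
  Unique.++⁺ (Unique.map⁺ ∷-injectiveʳ (ncmfs-unique k))
             (Unique-map⁺-injectiveOn grow grow-injective (All.tabulate (ncmfs-zeroEnded k)) (ncmfs-unique k))
             disjoint
  where
  disjoint : ∀ {v} → v ∈ map (0 ∷_) (ncmfs k) × v ∈ map grow (ncmfs k) → ⊥
  disjoint (v∈₁ , v∈₂) with ∈-map⁻ (0 ∷_) v∈₁ | ∈-map⁻ grow v∈₂
  ... | u , u∈ , refl | u′ , _ , 0∷u≡grow-u′ = 0∷≢grow u u′ (proj₁ (ncmfs-zeroEnded k u∈)) 0∷u≡grow-u′

length-ncmfs : ∀ k → length (ncmfs k) ≡ 2 ^ k
length-ncmfs zero    = refl
length-ncmfs (suc k) = begin
  length (map (0 ∷_) (ncmfs k) ++ map grow (ncmfs k))          ≡⟨ length-++ (map (0 ∷_) (ncmfs k)) ⟩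
  length (map (0 ∷_) (ncmfs k)) + length (map grow (ncmfs k))  ≡⟨ cong₂ _+_ (length-map (0 ∷_) (ncmfs k)) (length-map grow (ncmfs k)) ⟩
  length (ncmfs k) + length (ncmfs k)                          ≡⟨ cong (λ m → m + m) (length-ncmfs k) ⟩
  2 ^ k + 2 ^ k                                                ≡⟨ cong (2 ^ k +_) (sym (+-identityʳ (2 ^ k))) ⟩
  2 ^ suc k                                                    ∎
  where open ≡-Reasoning

NumberOfNCMF-2+k : ∀ k → NumberOfNCMF (2 + k) (2 ^ k)
NumberOfNCMF-2+k k =
  ncmfs k , ncmfs-unique k ,
  (λ v → mk⇔ (IsNCMF⇒NCMF v ∘ ncmfs-sound k) (ncmfs-complete k v ∘ NCMF⇒IsNCMF v)) ,
  length-ncmfs k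

NumberOfNCMF-1 : NumberOfNCMF 1 1
NumberOfNCMF-1 = (0 ∷ []) ∷ [] , [] ∷ [] , (λ v → mk⇔ (sound v) (complete v)) , refl
  where
  sound : ∀ v → v ∈ (0 ∷ []) ∷ [] → NCMF v
  sound v (here refl) = IsNCMF⇒NCMF (0 ∷ []) IsNCMF-[0]
  complete : ∀ v → NCMF v → v ∈ (0 ∷ []) ∷ []
  complete (x ∷ []) h with IsRGS⇒head≡0 (proj₁ (NCMF⇒IsNCMF (x ∷ []) h)) here
  ... | refl = here refl

corollary38 : NumberOfNCMF 1 1 × (∀ (n : ℕ) → 2 ≤ n → NumberOfNCMF n (2 ^ (n ∸ 2)))
corollary38 = NumberOfNCMF-1 , λ { (suc (suc k)) (s≤s (s≤s z≤n)) → NumberOfNCMF-2+k k }
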